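{- Let $(\mathcal V,1,\otimes)$ be a symmetric monoidal category with finite limits whose unit $1$ is a terminal object, let $\mathbb C,\mathbb D$ be internal categories in $\mathcal V$, and let $(\mathbb C\otimes\mathbb D)_k$ ($k=0,1,2,3$), $\mathit{comp}$, $\mathit{compl}$, $\mathit{compr}$ be as in the context. Then $\mathit{comp}\circ\mathit{compl}=\mathit{comp}\circ\mathit{compr}$.
   Context: For objects $X,Y$ of $\mathcal V$, $j:X\otimes Y\to X\times Y$ denotes the canonical arrow whose components are $X\otimes Y\to X\otimes 1\cong X$ and $X\otimes Y\to 1\otimes Y\cong Y$. An internal category $\mathbb C$ in $\mathcal V$ consists of objects $\mathbb C_0,\mathbb C_1$, arrows $\mathit{dom},\mathit{cod}:\mathbb C_1\to\mathbb C_0$, $i:\mathbb C_0\to\mathbb C_1$, the pullback $\mathbb C_2$ of $\mathit{cod}$ and $\mathit{dom}$ with projections $\pi_1,\pi_2$, and $\mathit{comp}:\mathbb C_2\to\mathbb C_1$, satisfying the usual identity, domain/codomain and associativity axioms. Given internal categories $\mathbb C,\mathbb D$: $(\mathbb C\otimes\mathbb D)_0:=\mathbb C_0\otimes\mathbb D_0$; $(\mathbb C\otimes\mathbb D)_1$ is the limit, with arrows $\mathit{dom},\mathit{cod}:(\mathbb C\otimes\mathbb D)_1\to(\mathbb C\otimes\mathbb D)_0$ and $j_1:(\mathbb C\otimes\mathbb D)_1\to\mathbb C_1\times\mathbb D_1$, universal with $j\circ\mathit{dom}=(\mathit{dom}\times\mathit{dom})\circ j_1$ and $j\circ\mathit{cod}=(\mathit{cod}\times\mathit{cod})\circ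 j_1$; $(\mathbb C\otimes\mathbb D)_2$ is the pullback of $\mathit{cod}$ and $\mathit{dom}$ on $(\mathbb C\otimes\mathbb D)_1$ with projections $\pi_1,\pi_2$; $j_2:(\mathbb C\otimes\mathbb D)_2\to\mathbb C_2\times\mathbb D_2$ is the unique arrow with $(\pi_k\times\pi_k)\circ j_2=j_1\circ\pi_k$ ($k=1,2$). The arrow $\mathit{comp}:(\mathbb C\otimes\mathbb D)_2\to(\mathbb C\otimes\mathbb D)_1$ is the unique arrow with $\mathit{dom}\circ\mathit{comp}=\mathit{dom}\circ\pi_1$, $\mathit{cod}\circ\mathit{comp}=\mathit{cod}\circ\pi_2$ and $j_1\circ\mathit{comp}=(\mathit{comp}\times\mathit{comp})\circ j_2$. $(\mathbb C\otimes\mathbb D)_3$ is the pullback of $\pi_2:(\mathbb C\otimes\mathbb D)_2\to(\mathbb C\otimes\mathbb D)_1$ and $\pi_1:(\mathbb C\otimes\mathbb D)_2\to(\mathbb C\otimes\mathbb D)_1$, with projections $\mathit{left},\mathit{right}:(\mathbb C\otimes\mathbb D)_3\to(\mathbb C\otimes\mathbb D)_2$ satisfying $\pi_2\circ\mathit{left}=\pi_1\circ\mathit{right}$. $\mathit{compl}:(\mathbb C\otimes\mathbb D)_3\to(\mathbb C\otimes\mathbb D)_2$ is the unique arrow with $\pi_1\circ\mathit{compl}=\mathit{comp}\circ\mathit{left}$ and $\pi_2\circ\mathit{compl}=\pi_2\circ\mathit{right}$; $\mathit{compr}$ is the unique arrow with $\pi_1\circ\mathit{compr}=\pi_1\circ\mathit{left}$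 and $\pi_2\circ\mathit{compr}=\mathit{comp}\circ\mathit{right}$. -}

module Defs where

open import Level using (Level; _⊔_) renaming (suc to lsuc)
open import Relation.Binary.PropositionalEquality
open ≡-Reasoning

record Category (o ℓ : Level) : Set (lsuc (o ⊔ ℓ)) where
  infixr 9 _∘_
  field
    Obj : Set o
    Hom : Obj → Obj → Set ℓ
    id  : ∀ {A} → Hom A A
    _∘_ : ∀ {A B C} → Hom B C → Hom A B → Hom A C
    identityˡ : ∀ {A B} {f : Hom A B} → id ∘ f ≡ f
    identityʳ : ∀ {A B} {f : Hom A B} → f ∘ id ≡ f
    assoc : ∀ {A B C D} {f : Hom A B} {g : Hom B C} {h : Hom C D} →
            (h ∘ g) ∘ f ≡ h ∘ (g ∘ f)

module _ {o ℓ} (𝒞 : Category o ℓ) where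
  open Category 𝒞

  record IsTerminal (T : Obj) : Set (o ⊔ ℓ) where
    field
      ! : ∀ {A} → Hom A T
      !-unique : ∀ {A} (f : Hom A T) → f ≡ !

  record Product (A B : Obj) : Set (o ⊔ ℓ) where
    field
      A×B : Obj
      p₁ : Hom A×B A
      p₂ : Hom A×B B
      ⟨_,_⟩ : ∀ {X} → Hom X A → Hom X B → Hom X A×B
      p₁∘⟨⟩ : ∀ {X} {f : Hom X A} {g : Hom X B} → p₁ ∘ ⟨ f , g ⟩ ≡ f
      p₂∘⟨⟩ : ∀ {X} {f : Hom X A} {g : Hom X B} → p₂ ∘ ⟨ f , g ⟩ ≡ g
      ⟨⟩-unique : ∀ {X} {f : Hom X A} {g : Hom X B} (h : Hom X A×B) →
                  p₁ ∘ h ≡ f → p₂ ∘ h ≡ g → h ≡ ⟨ f , g ⟩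

  record Pullback {A B C : Obj} (f : Hom A C) (g : Hom B C) : Set (o ⊔ ℓ) where
    field
      P : Obj
      q₁ : Hom P A
      q₂ : Hom P B
      commute : f ∘ q₁ ≡ g ∘ q₂
      universal : ∀ {X} (h₁ : Hom X A) (h₂ : Hom X B) → f ∘ h₁ ≡ g ∘ h₂ → Hom X P
      q₁∘universal : ∀ {X} {h₁ : Hom X A} {h₂ : Hom X B} {eq : f ∘ h₁ ≡ g ∘ h₂} →
                     q₁ ∘ universal h₁ h₂ eq ≡ h₁
      q₂∘universal : ∀ {X} {h₁ : Hom X A} {h₂ : Hom X B} {eq : f ∘ h₁ ≡ g ∘ h₂} →
                     q₂ ∘ universal h₁ h₂ eq ≡ h₂
      unique : ∀ {X} {h₁ : Hom X A} {h₂ : Hom X B} {eq : f ∘ h₁ ≡ g ∘ h₂} (h : Hom X P) →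
               q₁ ∘ h ≡ h₁ → q₂ ∘ h ≡ h₂ → h ≡ universal h₁ h₂ eq

  -- finite limits: a terminal object and pullbacks (which generate all
  -- finite limits); binary products are included as chosen structure too.
  record FiniteLimits : Set (o ⊔ ℓ) where
    field
      terminal : Obj
      terminal-isTerminal : IsTerminal terminal
      product : ∀ A B → Product A B
      pullback : ∀ {A B C} (f : Hom A C) (g : Hom B C) → Pullback f g

  record SymmetricMonoidal : Set (o ⊔ ℓ) where
    infixr 10 _⊗₀_ _⊗₁_
    field
      _⊗₀_ : Obj → Obj → Obj
      _⊗₁_ : ∀ {A B C D} → Hom A B → Hom C D → Hom (A ⊗₀ C) (B ⊗₀ D)
      ⊗-identity : ∀ {A B} → id {A} ⊗₁ id {B} ≡ id
      ⊗-homomorphism : ∀ {A B C D E F} {f : Hom A B} {g : Hom B C} {h : Hom D E} {k : Hom E F} →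
                       (g ∘ f) ⊗₁ (k ∘ h) ≡ (g ⊗₁ k) ∘ (f ⊗₁ h)
      unit : Obj
      lu  : ∀ {A} → Hom (unit ⊗₀ A) A
      lu⁻ : ∀ {A} → Hom A (unit ⊗₀ A)
      ru  : ∀ {A} → Hom (A ⊗₀ unit) A
      ru⁻ : ∀ {A} → Hom A (A ⊗₀ unit)
      as  : ∀ {A B C} → Hom ((A ⊗₀ B) ⊗₀ C) (A ⊗₀ (B ⊗₀ C))
      as⁻ : ∀ {A B C} → Hom (A ⊗₀ (B ⊗₀ C)) ((A ⊗₀ B) ⊗₀ C)
      br  : ∀ {A B} → Hom (A ⊗₀ B) (B ⊗₀ A)
      lu-iso₁ : ∀ {A} → lu {A} ∘ lu⁻ ≡ id
      lu-iso₂ : ∀ {A} → lu⁻ {A} ∘ lu ≡ id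
      ru-iso₁ : ∀ {A} → ru {A} ∘ ru⁻ ≡ id
      ru-iso₂ : ∀ {A} → ru⁻ {A} ∘ ru ≡ id
      as-iso₁ : ∀ {A B C} → as {A} {B} {C} ∘ as⁻ ≡ id
      as-iso₂ : ∀ {A B C} → as⁻ {A} {B} {C} ∘ as ≡ id
      lu-natural : ∀ {A B} {f : Hom A B} → lu ∘ (id ⊗₁ f) ≡ f ∘ lu
      ru-natural : ∀ {A B} {f : Hom A B} → ru ∘ (f ⊗₁ id) ≡ f ∘ ru
      as-natural : ∀ {A B C D E F} {f : Hom A B} {g : Hom C D} {h : Hom E F} →
                   as ∘ ((f ⊗₁ g) ⊗₁ h) ≡ (f ⊗₁ (g ⊗₁ h)) ∘ as
      br-natural : ∀ {A B C D} {f : Hom A B} {g : Hom C D} →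
                   br ∘ (f ⊗₁ g) ≡ (g ⊗₁ f) ∘ br
      triangle : ∀ {A B} → (id {A} ⊗₁ lu {B}) ∘ as ≡ ru ⊗₁ id
      pentagon : ∀ {A B C D} →
                 (id {A} ⊗₁ as {B} {C} {D}) ∘ (as ∘ (as ⊗₁ id)) ≡ as ∘ as
      hexagon : ∀ {A B C} →
                as {B} {C} {A} ∘ (br ∘ as) ≡ (id ⊗₁ br) ∘ (as ∘ (br ⊗₁ id))
      symmetry : ∀ {A B} → br {B} {A} ∘ br {A} {B} ≡ id

module WithLimits {o ℓ} {𝒞 : Category o ℓ} (FL : FiniteLimits 𝒞) where
  open Category 𝒞
  open FiniteLimits FL

  module Triples {A B : Obj} (dom cod : Hom A B)
      (comp : Hom (Pullback.P (pullback cod dom)) A)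
      (dom-comp : dom ∘ comp ≡ dom ∘ Pullback.q₁ (pullback cod dom))
      (cod-comp : cod ∘ comp ≡ cod ∘ Pullback.q₂ (pullback cod dom)) where
    private
      module P₂ = Pullback (pullback cod dom)
    P₃ : Pullback 𝒞 P₂.q₂ P₂.q₁
    P₃ = pullback P₂.q₂ P₂.q₁
    private
      module P₃ = Pullback P₃
    left right : Hom P₃.P P₂.P
    left = P₃.q₁
    right = P₃.q₂

    compl : Hom P₃.P P₂.P
    compl = P₂.universal (comp ∘ left) (P₂.q₂ ∘ right) eqL
      where
      eqL : cod ∘ (comp ∘ left) ≡ dom ∘ (P₂.q₂ ∘ right)
      eqL = begin
        cod ∘ (comp ∘ left)       ≡⟨ sym assoc ⟩
        (cod ∘ comp) ∘ left       ≡⟨ cong (_∘ left) cod-comp ⟩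
        (cod ∘ P₂.q₂) ∘ left      ≡⟨ assoc ⟩
        cod ∘ (P₂.q₂ ∘ left)      ≡⟨ cong (cod ∘_) P₃.commute ⟩
        cod ∘ (P₂.q₁ ∘ right)     ≡⟨ sym assoc ⟩
        (cod ∘ P₂.q₁) ∘ right     ≡⟨ cong (_∘ right) P₂.commute ⟩
        (dom ∘ P₂.q₂) ∘ right     ≡⟨ assoc ⟩
        dom ∘ (P₂.q₂ ∘ right)     ∎

    compr : Hom P₃.P P₂.P
    compr = P₂.universal (P₂.q₁ ∘ left) (comp ∘ right) eqR
      where
      eqR : cod ∘ (P₂.q₁ ∘ left) ≡ dom ∘ (comp ∘ right)
      eqR = begin
        cod ∘ (P₂.q₁ ∘ left)      ≡⟨ sym assoc ⟩
        (cod ∘ P₂.q₁) ∘ left      ≡⟨ cong (_∘ left) P₂.commute ⟩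
        (dom ∘ P₂.q₂) ∘ left      ≡⟨ assoc ⟩
        dom ∘ (P₂.q₂ ∘ left)      ≡⟨ cong (dom ∘_) P₃.commute ⟩
        dom ∘ (P₂.q₁ ∘ right)     ≡⟨ sym assoc ⟩
        (dom ∘ P₂.q₁) ∘ right     ≡⟨ cong (_∘ right) (sym dom-comp) ⟩
        (dom ∘ comp) ∘ right      ≡⟨ assoc ⟩
        dom ∘ (comp ∘ right)      ∎

  module Units {A B : Obj} (dom cod : Hom A B) (i : Hom B A)
      (dom-i : dom ∘ i ≡ id) (cod-i : cod ∘ i ≡ id) where
    private
      module P₂ = Pullback (pullback cod dom)
    idˡ-pair : Hom A P₂.P
    idˡ-pair = P₂.universal (i ∘ dom) id
      (trans (sym assoc) (trans (cong (_∘ dom) cod-i) (trans identityˡ (sym identityʳ))))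
    idʳ-pair : Hom A P₂.P
    idʳ-pair = P₂.universal id (i ∘ cod)
      (trans identityʳ (trans (sym identityˡ) (trans (cong (_∘ cod) (sym dom-i)) assoc)))

  record InternalCategory : Set (o ⊔ ℓ) where
    field
      C₀ C₁ : Obj
      dom cod : Hom C₁ C₀
      i : Hom C₀ C₁
      -- C₂ is the (chosen) pullback of cod and dom, π₁ = q₁, π₂ = q₂
      comp : Hom (Pullback.P (pullback cod dom)) C₁
      dom-i : dom ∘ i ≡ id
      cod-i : cod ∘ i ≡ id
      dom-comp : dom ∘ comp ≡ dom ∘ Pullback.q₁ (pullback cod dom)
      cod-comp : cod ∘ comp ≡ cod ∘ Pullback.q₂ (pullback cod dom)
      comp-identityˡ : comp ∘ Units.idˡ-pair dom cod i dom-i cod-i ≡ id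
      comp-identityʳ : comp ∘ Units.idʳ-pair dom cod i dom-i cod-i ≡ id
      comp-assoc : comp ∘ Triples.compl dom cod comp dom-comp cod-comp
                   ≡ comp ∘ Triples.compr dom cod comp dom-comp cod-comp

module TensorProduct {o ℓ} {𝒞 : Category o ℓ} (FL : FiniteLimits 𝒞)
    (SM : SymmetricMonoidal 𝒞)
    (unit-terminal : IsTerminal 𝒞 (SymmetricMonoidal.unit SM)) where
  open Category 𝒞
  open FiniteLimits FL
  open SymmetricMonoidal SM
  open IsTerminal unit-terminal
  open WithLimits FL

  infixr 7 _×_ _×₁_
  _×_ : Obj → Obj → Obj
  A × B = Product.A×B (product A B)

  fst : ∀ {A B} → Hom (A × B) A
  fst {A} {B} = Product.p₁ (product A B)

  snd : ∀ {A B} → Hom (A × B) B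
  snd {A} {B} = Product.p₂ (product A B)

  ⟨_,_⟩ : ∀ {X A B} → Hom X A → Hom X B → Hom X (A × B)
  ⟨_,_⟩ {A = A} {B} f g = Product.⟨_,_⟩ (product A B) f g

  _×₁_ : ∀ {A A′ B B′} → Hom A A′ → Hom B B′ → Hom (A × B) (A′ × B′)
  f ×₁ g = ⟨ f ∘ fst , g ∘ snd ⟩

  j : ∀ {X Y} → Hom (X ⊗₀ Y) (X × Y)
  j = ⟨ ru ∘ (id ⊗₁ !) , lu ∘ (! ⊗₁ id) ⟩

  fst-⟨⟩ : ∀ {X A B} {f : Hom X A} {g : Hom X B} → fst ∘ ⟨ f , g ⟩ ≡ f
  fst-⟨⟩ {A = A} {B} = Product.p₁∘⟨⟩ (product A B)

  snd-⟨⟩ : ∀ {X A B} {f : Hom X A} {g : Hom X B} → snd ∘ ⟨ f , g ⟩ ≡ g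
  snd-⟨⟩ {A = A} {B} = Product.p₂∘⟨⟩ (product A B)

  ×-fst : ∀ {X A A′ B B′} {f : Hom A A′} {g : Hom B B′} {h : Hom X (A × B)} →
          fst ∘ ((f ×₁ g) ∘ h) ≡ f ∘ (fst ∘ h)
  ×-fst {h = h} = trans (sym assoc) (trans (cong (_∘ h) fst-⟨⟩) assoc)

  ×-snd : ∀ {X A A′ B B′} {f : Hom A A′} {g : Hom B B′} {h : Hom X (A × B)} →
          snd ∘ ((f ×₁ g) ∘ h) ≡ g ∘ (snd ∘ h)
  ×-snd {h = h} = trans (sym assoc) (trans (cong (_∘ h) snd-⟨⟩) assoc)

  prod-ext : ∀ {X A B} {f g : Hom X (A × B)} → fst ∘ f ≡ fst ∘ g → snd ∘ f ≡ snd ∘ g → f ≡ g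
  prod-ext {A = A} {B} {f} {g} e₁ e₂ =
    trans (Product.⟨⟩-unique (product A B) f e₁ e₂)
          (sym (Product.⟨⟩-unique (product A B) g refl refl))

  module Over (ℂ 𝔻 : InternalCategory) where
    module C = InternalCategory ℂ
    module D = InternalCategory 𝔻
    module CP = Pullback (pullback C.cod C.dom)
    module DP = Pullback (pullback D.cod D.dom)

    record TensorArrows : Set (o ⊔ ℓ) where
      field
        L : Obj
        dom cod : Hom L (C.C₀ ⊗₀ D.C₀)
        j₁ : Hom L (C.C₁ × D.C₁)
        dom-j : j ∘ dom ≡ (C.dom ×₁ D.dom) ∘ j₁
        cod-j : j ∘ cod ≡ (C.cod ×₁ D.cod) ∘ j₁
        universal : ∀ {X} (a b : Hom X (C.C₀ ⊗₀ D.C₀)) (c : Hom X (C.C₁ × D.C₁)) →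
                    j ∘ a ≡ (C.dom ×₁ D.dom) ∘ c → j ∘ b ≡ (C.cod ×₁ D.cod) ∘ c → Hom X L
        dom∘universal : ∀ {X} {a b : Hom X (C.C₀ ⊗₀ D.C₀)} {c : Hom X (C.C₁ × D.C₁)}
                        {e₁ : j ∘ a ≡ (C.dom ×₁ D.dom) ∘ c} {e₂ : j ∘ b ≡ (C.cod ×₁ D.cod) ∘ c} →
                        dom ∘ universal a b c e₁ e₂ ≡ a
        cod∘universal : ∀ {X} {a b : Hom X (C.C₀ ⊗₀ D.C₀)} {c : Hom X (C.C₁ × D.C₁)}
                        {e₁ : j ∘ a ≡ (C.dom ×₁ D.dom) ∘ c} {e₂ : j ∘ b ≡ (C.cod ×₁ D.cod) ∘ c} →
                        cod ∘ universal a b c e₁ e₂ ≡ b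
        j₁∘universal : ∀ {X} {a b : Hom X (C.C₀ ⊗₀ D.C₀)} {c : Hom X (C.C₁ × D.C₁)}
                       {e₁ : j ∘ a ≡ (C.dom ×₁ D.dom) ∘ c} {e₂ : j ∘ b ≡ (C.cod ×₁ D.cod) ∘ c} →
                       j₁ ∘ universal a b c e₁ e₂ ≡ c
        unique : ∀ {X} {a b : Hom X (C.C₀ ⊗₀ D.C₀)} {c : Hom X (C.C₁ × D.C₁)}
                 {e₁ : j ∘ a ≡ (C.dom ×₁ D.dom) ∘ c} {e₂ : j ∘ b ≡ (C.cod ×₁ D.cod) ∘ c}
                 (h : Hom X L) → dom ∘ h ≡ a → cod ∘ h ≡ b → j₁ ∘ h ≡ c →
                 h ≡ universal a b c e₁ e₂

    module Construction (T : TensorArrows) where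
      open TensorArrows T renaming (dom to tdom; cod to tcod; universal to tuniversal)
      module P₂ = Pullback (pullback tcod tdom)

      genfst : (f : Hom C.C₁ C.C₀) (g : Hom D.C₁ D.C₀) (t : Hom L (C.C₀ ⊗₀ D.C₀))
               (e : j ∘ t ≡ (f ×₁ g) ∘ j₁) {X : Obj} (h : Hom X L) →
               f ∘ (fst ∘ (j₁ ∘ h)) ≡ fst ∘ (j ∘ (t ∘ h))
      genfst f g t e h = begin
        f ∘ (fst ∘ (j₁ ∘ h))         ≡⟨ sym ×-fst ⟩
        fst ∘ ((f ×₁ g) ∘ (j₁ ∘ h))  ≡⟨ cong (fst ∘_) (sym assoc) ⟩
        fst ∘ (((f ×₁ g) ∘ j₁) ∘ h)  ≡⟨ cong (λ z → fst ∘ (z ∘ h)) (sym e) ⟩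
        fst ∘ ((j ∘ t) ∘ h)          ≡⟨ cong (fst ∘_) assoc ⟩
        fst ∘ (j ∘ (t ∘ h))          ∎

      gensnd : (f : Hom C.C₁ C.C₀) (g : Hom D.C₁ D.C₀) (t : Hom L (C.C₀ ⊗₀ D.C₀))
               (e : j ∘ t ≡ (f ×₁ g) ∘ j₁) {X : Obj} (h : Hom X L) →
               g ∘ (snd ∘ (j₁ ∘ h)) ≡ snd ∘ (j ∘ (t ∘ h))
      gensnd f g t e h = begin
        g ∘ (snd ∘ (j₁ ∘ h))         ≡⟨ sym ×-snd ⟩
        snd ∘ ((f ×₁ g) ∘ (j₁ ∘ h))  ≡⟨ cong (snd ∘_) (sym assoc) ⟩
        snd ∘ (((f ×₁ g) ∘ j₁) ∘ h)  ≡⟨ cong (λ z → snd ∘ (z ∘ h)) (sym e) ⟩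
        snd ∘ ((j ∘ t) ∘ h)          ≡⟨ cong (snd ∘_) assoc ⟩
        snd ∘ (j ∘ (t ∘ h))          ∎

      uC : Hom P₂.P CP.P
      uC = CP.universal (fst ∘ (j₁ ∘ P₂.q₁)) (fst ∘ (j₁ ∘ P₂.q₂))
             (trans (genfst C.cod D.cod tcod cod-j P₂.q₁)
               (trans (cong (λ z → fst ∘ (j ∘ z)) P₂.commute)
                 (sym (genfst C.dom D.dom tdom dom-j P₂.q₂))))

      uD : Hom P₂.P DP.P
      uD = DP.universal (snd ∘ (j₁ ∘ P₂.q₁)) (snd ∘ (j₁ ∘ P₂.q₂))
             (trans (gensnd C.cod D.cod tcod cod-j P₂.q₁)
               (trans (cong (λ z → snd ∘ (j ∘ z)) P₂.commute)
                 (sym (gensnd C.dom D.dom tdom dom-j P₂.q₂))))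

      j₂ : Hom P₂.P (CP.P × DP.P)
      j₂ = ⟨ uC , uD ⟩

      private
        eqdom : j ∘ (tdom ∘ P₂.q₁) ≡ (C.dom ×₁ D.dom) ∘ ((C.comp ×₁ D.comp) ∘ j₂)
        eqdom = prod-ext
          (begin
            fst ∘ (j ∘ (tdom ∘ P₂.q₁))       ≡⟨ sym (genfst C.dom D.dom tdom dom-j P₂.q₁) ⟩
            C.dom ∘ (fst ∘ (j₁ ∘ P₂.q₁))     ≡⟨ cong (C.dom ∘_) (sym CP.q₁∘universal) ⟩
            C.dom ∘ (CP.q₁ ∘ uC)             ≡⟨ sym assoc ⟩
            (C.dom ∘ CP.q₁) ∘ uC             ≡⟨ cong (_∘ uC) (sym C.dom-comp) ⟩
            (C.dom ∘ C.comp) ∘ uC            ≡⟨ assoc ⟩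
            C.dom ∘ (C.comp ∘ uC)            ≡⟨ cong (λ z → C.dom ∘ (C.comp ∘ z)) (sym fst-⟨⟩) ⟩
            C.dom ∘ (C.comp ∘ (fst ∘ j₂))    ≡⟨ cong (C.dom ∘_) (sym ×-fst) ⟩
            C.dom ∘ (fst ∘ ((C.comp ×₁ D.comp) ∘ j₂)) ≡⟨ sym ×-fst ⟩
            fst ∘ ((C.dom ×₁ D.dom) ∘ ((C.comp ×₁ D.comp) ∘ j₂)) ∎)
          (begin
            snd ∘ (j ∘ (tdom ∘ P₂.q₁))       ≡⟨ sym (gensnd C.dom D.dom tdom dom-j P₂.q₁) ⟩
            D.dom ∘ (snd ∘ (j₁ ∘ P₂.q₁))     ≡⟨ cong (D.dom ∘_) (sym DP.q₁∘universal) ⟩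
            D.dom ∘ (DP.q₁ ∘ uD)             ≡⟨ sym assoc ⟩
            (D.dom ∘ DP.q₁) ∘ uD             ≡⟨ cong (_∘ uD) (sym D.dom-comp) ⟩
            (D.dom ∘ D.comp) ∘ uD            ≡⟨ assoc ⟩
            D.dom ∘ (D.comp ∘ uD)            ≡⟨ cong (λ z → D.dom ∘ (D.comp ∘ z)) (sym snd-⟨⟩) ⟩
            D.dom ∘ (D.comp ∘ (snd ∘ j₂))    ≡⟨ cong (D.dom ∘_) (sym ×-snd) ⟩
            D.dom ∘ (snd ∘ ((C.comp ×₁ D.comp) ∘ j₂)) ≡⟨ sym ×-snd ⟩
            snd ∘ ((C.dom ×₁ D.dom) ∘ ((C.comp ×₁ D.comp) ∘ j₂)) ∎)

        eqcod : j ∘ (tcod ∘ P₂.q₂) ≡ (C.cod ×₁ D.cod) ∘ ((C.comp ×₁ D.comp) ∘ j₂)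
        eqcod = prod-ext
          (begin
            fst ∘ (j ∘ (tcod ∘ P₂.q₂))       ≡⟨ sym (genfst C.cod D.cod tcod cod-j P₂.q₂) ⟩
            C.cod ∘ (fst ∘ (j₁ ∘ P₂.q₂))     ≡⟨ cong (C.cod ∘_) (sym CP.q₂∘universal) ⟩
            C.cod ∘ (CP.q₂ ∘ uC)             ≡⟨ sym assoc ⟩
            (C.cod ∘ CP.q₂) ∘ uC             ≡⟨ cong (_∘ uC) (sym C.cod-comp) ⟩
            (C.cod ∘ C.comp) ∘ uC            ≡⟨ assoc ⟩
            C.cod ∘ (C.comp ∘ uC)            ≡⟨ cong (λ z → C.cod ∘ (C.comp ∘ z)) (sym fst-⟨⟩) ⟩
            C.cod ∘ (C.comp ∘ (fst ∘ j₂))    ≡⟨ cong (C.cod ∘_) (sym ×-fst) ⟩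
            C.cod ∘ (fst ∘ ((C.comp ×₁ D.comp) ∘ j₂)) ≡⟨ sym ×-fst ⟩
            fst ∘ ((C.cod ×₁ D.cod) ∘ ((C.comp ×₁ D.comp) ∘ j₂)) ∎)
          (begin
            snd ∘ (j ∘ (tcod ∘ P₂.q₂))       ≡⟨ sym (gensnd C.cod D.cod tcod cod-j P₂.q₂) ⟩
            D.cod ∘ (snd ∘ (j₁ ∘ P₂.q₂))     ≡⟨ cong (D.cod ∘_) (sym DP.q₂∘universal) ⟩
            D.cod ∘ (DP.q₂ ∘ uD)             ≡⟨ sym assoc ⟩
            (D.cod ∘ DP.q₂) ∘ uD             ≡⟨ cong (_∘ uD) (sym D.cod-comp) ⟩
            (D.cod ∘ D.comp) ∘ uD            ≡⟨ assoc ⟩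
            D.cod ∘ (D.comp ∘ uD)            ≡⟨ cong (λ z → D.cod ∘ (D.comp ∘ z)) (sym snd-⟨⟩) ⟩
            D.cod ∘ (D.comp ∘ (snd ∘ j₂))    ≡⟨ cong (D.cod ∘_) (sym ×-snd) ⟩
            D.cod ∘ (snd ∘ ((C.comp ×₁ D.comp) ∘ j₂)) ≡⟨ sym ×-snd ⟩
            snd ∘ ((C.cod ×₁ D.cod) ∘ ((C.comp ×₁ D.comp) ∘ j₂)) ∎)

      comp : Hom P₂.P L
      comp = tuniversal (tdom ∘ P₂.q₁) (tcod ∘ P₂.q₂) ((C.comp ×₁ D.comp) ∘ j₂) eqdom eqcod

      dom-comp : tdom ∘ comp ≡ tdom ∘ P₂.q₁
      dom-comp = dom∘universal

      cod-comp : tcod ∘ comp ≡ tcod ∘ P₂.q₂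
      cod-comp = cod∘universal

      open Triples tdom tcod comp dom-comp cod-comp public

-- The arrow object (ℂ ⊗ 𝔻)₁ is a limit, so an arrow into it is determined by its
-- domain, its codomain and the two components of j₁. The domains and codomains of
-- the two bracketings of a composable triple agree for any graph with a composition.
-- The components fst ∘ j₁ and snd ∘ j₁ are the arrow parts of the projections onto
-- ℂ and 𝔻, which preserve composition; such a map carries compl and compr to the
-- corresponding maps of the target, so associativity of ℂ and of 𝔻 yields agreement
-- of the components.
module Submission where

open import Defs
open import Level using (Level; _⊔_)
open import Relation.Binary.PropositionalEquality
open ≡-Reasoning

module CategoryLemmas {o ℓ} (𝒞 : Category o ℓ) where
  open Category 𝒞

  pullˡ : ∀ {A B C X} {f : Hom B C} {g : Hom A B} {k : Hom A C} {h : Hom X A} →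
          f ∘ g ≡ k → f ∘ g ∘ h ≡ k ∘ h
  pullˡ {h = h} e = trans (sym assoc) (cong (_∘ h) e)

  extendʳ : ∀ {A B B′ C X} {f : Hom B C} {g : Hom A B} {k : Hom B′ C} {l : Hom A B′} {h : Hom X A} →
            f ∘ g ≡ k ∘ l → f ∘ g ∘ h ≡ k ∘ l ∘ h
  extendʳ e = trans (pullˡ e) assoc

  Pullback-ext : ∀ {A B C} {F : Hom A C} {G : Hom B C} (p : Pullback 𝒞 F G) {X}
                 {f g : Hom X (Pullback.P p)} →
                 Pullback.q₁ p ∘ f ≡ Pullback.q₁ p ∘ g → Pullback.q₂ p ∘ f ≡ Pullback.q₂ p ∘ g →
                 f ≡ g
  Pullback-ext p {f = f} {g} e₁ e₂ =
    trans (unique {eq = commutes} f refl refl) (sym (unique {eq = commutes} g (sym e₁) (sym e₂)))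
    where
    open Pullback p
    commutes = trans (sym assoc) (trans (cong (_∘ f) commute) assoc)

module Composition {o ℓ} {𝒞 : Category o ℓ} (FL : FiniteLimits 𝒞) where
  open Category 𝒞
  open FiniteLimits FL
  open WithLimits FL
  open CategoryLemmas 𝒞

  record GraphWithComposition : Set (o ⊔ ℓ) where
    field
      Ob Ar : Obj
      dom cod : Hom Ar Ob
      comp : Hom (Pullback.P (pullback cod dom)) Ar
      dom-comp : dom ∘ comp ≡ dom ∘ Pullback.q₁ (pullback cod dom)
      cod-comp : cod ∘ comp ≡ cod ∘ Pullback.q₂ (pullback cod dom)

    module Pairs = Pullback (pullback cod dom)
    open Triples dom cod comp dom-comp cod-comp public
    module Triple = Pullback P₃

    dom-comp-assoc : dom ∘ comp ∘ compl ≡ dom ∘ comp ∘ compr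
    dom-comp-assoc = begin
      dom ∘ comp ∘ compl            ≡⟨ extendʳ dom-comp ⟩
      dom ∘ Pairs.q₁ ∘ compl        ≡⟨ cong (dom ∘_) Pairs.q₁∘universal ⟩
      dom ∘ comp ∘ left             ≡⟨ extendʳ dom-comp ⟩
      dom ∘ Pairs.q₁ ∘ left         ≡⟨ cong (dom ∘_) (sym Pairs.q₁∘universal) ⟩
      dom ∘ Pairs.q₁ ∘ compr        ≡⟨ sym (extendʳ dom-comp) ⟩
      dom ∘ comp ∘ compr            ∎

    cod-comp-assoc : cod ∘ comp ∘ compl ≡ cod ∘ comp ∘ compr
    cod-comp-assoc = begin
      cod ∘ comp ∘ compl            ≡⟨ extendʳ cod-comp ⟩
      cod ∘ Pairs.q₂ ∘ compl        ≡⟨ cong (cod ∘_) Pairs.q₂∘universal ⟩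
      cod ∘ Pairs.q₂ ∘ right        ≡⟨ sym (extendʳ cod-comp) ⟩
      cod ∘ comp ∘ right            ≡⟨ cong (cod ∘_) (sym Pairs.q₂∘universal) ⟩
      cod ∘ Pairs.q₂ ∘ compr        ≡⟨ sym (extendʳ cod-comp) ⟩
      cod ∘ comp ∘ compr            ∎

  underlyingGraph : InternalCategory → GraphWithComposition
  underlyingGraph ℂ = record { InternalCategory ℂ renaming (C₀ to Ob; C₁ to Ar) }

  -- A composition-preserving graph morphism G → H, given by its arrow part f₁ and its
  -- action f₂ on composable pairs; no object part is needed for the argument.
  module Comparison (G H : GraphWithComposition) where
    private
      module G = GraphWithComposition G
      module H = GraphWithComposition H

    module _ (f₁ : Hom G.Ar H.Ar) (f₂ : Hom G.Pairs.P H.Pairs.P)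
        (q₁-f₂ : H.Pairs.q₁ ∘ f₂ ≡ f₁ ∘ G.Pairs.q₁)
        (q₂-f₂ : H.Pairs.q₂ ∘ f₂ ≡ f₁ ∘ G.Pairs.q₂)
        (f₁-comp : f₁ ∘ G.comp ≡ H.comp ∘ f₂) where

      f₃ : Hom G.Triple.P H.Triple.P
      f₃ = H.Triple.universal (f₂ ∘ G.left) (f₂ ∘ G.right)
             (trans (extendʳ q₂-f₂) (trans (cong (f₁ ∘_) G.Triple.commute) (sym (extendʳ q₁-f₂))))

      f₂-compl : f₂ ∘ G.compl ≡ H.compl ∘ f₃
      f₂-compl = Pullback-ext (pullback H.cod H.dom)
        (begin
          H.Pairs.q₁ ∘ f₂ ∘ G.compl     ≡⟨ extendʳ q₁-f₂ ⟩
          f₁ ∘ G.Pairs.q₁ ∘ G.compl     ≡⟨ cong (f₁ ∘_) G.Pairs.q₁∘universal ⟩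
          f₁ ∘ G.comp ∘ G.left          ≡⟨ extendʳ f₁-comp ⟩
          H.comp ∘ f₂ ∘ G.left          ≡⟨ cong (H.comp ∘_) (sym H.Triple.q₁∘universal) ⟩
          H.comp ∘ H.left ∘ f₃          ≡⟨ sym (extendʳ H.Pairs.q₁∘universal) ⟩
          H.Pairs.q₁ ∘ H.compl ∘ f₃     ∎)
        (begin
          H.Pairs.q₂ ∘ f₂ ∘ G.compl     ≡⟨ extendʳ q₂-f₂ ⟩
          f₁ ∘ G.Pairs.q₂ ∘ G.compl     ≡⟨ cong (f₁ ∘_) G.Pairs.q₂∘universal ⟩
          f₁ ∘ G.Pairs.q₂ ∘ G.right     ≡⟨ sym (extendʳ q₂-f₂) ⟩
          H.Pairs.q₂ ∘ f₂ ∘ G.right     ≡⟨ cong (H.Pairs.q₂ ∘_) (sym H.Triple.q₂∘universal) ⟩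
          H.Pairs.q₂ ∘ H.right ∘ f₃     ≡⟨ sym (extendʳ H.Pairs.q₂∘universal) ⟩
          H.Pairs.q₂ ∘ H.compl ∘ f₃     ∎)

      f₂-compr : f₂ ∘ G.compr ≡ H.compr ∘ f₃
      f₂-compr = Pullback-ext (pullback H.cod H.dom)
        (begin
          H.Pairs.q₁ ∘ f₂ ∘ G.compr     ≡⟨ extendʳ q₁-f₂ ⟩
          f₁ ∘ G.Pairs.q₁ ∘ G.compr     ≡⟨ cong (f₁ ∘_) G.Pairs.q₁∘universal ⟩
          f₁ ∘ G.Pairs.q₁ ∘ G.left      ≡⟨ sym (extendʳ q₁-f₂) ⟩
          H.Pairs.q₁ ∘ f₂ ∘ G.left      ≡⟨ cong (H.Pairs.q₁ ∘_) (sym H.Triple.q₁∘universal) ⟩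
          H.Pairs.q₁ ∘ H.left ∘ f₃      ≡⟨ sym (extendʳ H.Pairs.q₁∘universal) ⟩
          H.Pairs.q₁ ∘ H.compr ∘ f₃     ∎)
        (begin
          H.Pairs.q₂ ∘ f₂ ∘ G.compr     ≡⟨ extendʳ q₂-f₂ ⟩
          f₁ ∘ G.Pairs.q₂ ∘ G.compr     ≡⟨ cong (f₁ ∘_) G.Pairs.q₂∘universal ⟩
          f₁ ∘ G.comp ∘ G.right         ≡⟨ extendʳ f₁-comp ⟩
          H.comp ∘ f₂ ∘ G.right         ≡⟨ cong (H.comp ∘_) (sym H.Triple.q₂∘universal) ⟩
          H.comp ∘ H.right ∘ f₃         ≡⟨ sym (extendʳ H.Pairs.q₂∘universal) ⟩
          H.Pairs.q₂ ∘ H.compr ∘ f₃     ∎)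

      comp-assoc-reflect : H.comp ∘ H.compl ≡ H.comp ∘ H.compr →
                           f₁ ∘ G.comp ∘ G.compl ≡ f₁ ∘ G.comp ∘ G.compr
      comp-assoc-reflect H-assoc = begin
        f₁ ∘ G.comp ∘ G.compl         ≡⟨ extendʳ f₁-comp ⟩
        H.comp ∘ f₂ ∘ G.compl         ≡⟨ cong (H.comp ∘_) f₂-compl ⟩
        H.comp ∘ H.compl ∘ f₃         ≡⟨ extendʳ H-assoc ⟩
        H.comp ∘ H.compr ∘ f₃         ≡⟨ cong (H.comp ∘_) (sym f₂-compr) ⟩
        H.comp ∘ f₂ ∘ G.compr         ≡⟨ sym (extendʳ f₁-comp) ⟩
        f₁ ∘ G.comp ∘ G.compr         ∎

module TensorAssociativity {o ℓ : Level} (𝒞 : Category o ℓ) (FL : FiniteLimits 𝒞)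
    (SM : SymmetricMonoidal 𝒞)
    (unit-terminal : IsTerminal 𝒞 (SymmetricMonoidal.unit SM))
    (ℂ 𝔻 : WithLimits.InternalCategory FL)
    (T : TensorProduct.Over.TensorArrows FL SM unit-terminal ℂ 𝔻) where
  open Category 𝒞
  open TensorProduct FL SM unit-terminal
  open Over ℂ 𝔻
  open Construction T
  open TensorArrows T renaming (dom to tdom; cod to tcod)
  open Composition FL
  open CategoryLemmas 𝒞

  TensorArrows-ext : ∀ {X} {f g : Hom X L} → tdom ∘ f ≡ tdom ∘ g → tcod ∘ f ≡ tcod ∘ g →
                     j₁ ∘ f ≡ j₁ ∘ g → f ≡ g
  TensorArrows-ext {f = f} {g} e₁ e₂ e₃ =
    trans (unique {e₁ = dom-commutes} {e₂ = cod-commutes} f refl refl refl)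
          (sym (unique {e₁ = dom-commutes} {e₂ = cod-commutes} g (sym e₁) (sym e₂) (sym e₃)))
    where
    dom-commutes = extendʳ dom-j
    cod-commutes = extendʳ cod-j

  tensorGraph : GraphWithComposition
  tensorGraph = record
    { Ob = C.C₀ ⊗₀ D.C₀ ; Ar = L ; dom = tdom ; cod = tcod
    ; comp = comp ; dom-comp = dom-comp ; cod-comp = cod-comp }
    where open SymmetricMonoidal SM

  j₁-comp : j₁ ∘ comp ≡ (C.comp ×₁ D.comp) ∘ j₂
  j₁-comp = j₁∘universal

  fst-j₁-comp : (fst ∘ j₁) ∘ comp ≡ C.comp ∘ uC
  fst-j₁-comp = begin
    (fst ∘ j₁) ∘ comp                 ≡⟨ trans assoc (cong (fst ∘_) j₁-comp) ⟩
    fst ∘ (C.comp ×₁ D.comp) ∘ j₂     ≡⟨ ×-fst ⟩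
    C.comp ∘ fst ∘ j₂                 ≡⟨ cong (C.comp ∘_) fst-⟨⟩ ⟩
    C.comp ∘ uC                       ∎

  snd-j₁-comp : (snd ∘ j₁) ∘ comp ≡ D.comp ∘ uD
  snd-j₁-comp = begin
    (snd ∘ j₁) ∘ comp                 ≡⟨ trans assoc (cong (snd ∘_) j₁-comp) ⟩
    snd ∘ (C.comp ×₁ D.comp) ∘ j₂     ≡⟨ ×-snd ⟩
    D.comp ∘ snd ∘ j₂                 ≡⟨ cong (D.comp ∘_) snd-⟨⟩ ⟩
    D.comp ∘ uD                       ∎

  fst-j₁-comp-assoc : (fst ∘ j₁) ∘ comp ∘ compl ≡ (fst ∘ j₁) ∘ comp ∘ compr
  fst-j₁-comp-assoc = Comparison.comp-assoc-reflect tensorGraph (underlyingGraph ℂ) (fst ∘ j₁) uC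
    (trans CP.q₁∘universal (sym assoc)) (trans CP.q₂∘universal (sym assoc)) fst-j₁-comp C.comp-assoc

  snd-j₁-comp-assoc : (snd ∘ j₁) ∘ comp ∘ compl ≡ (snd ∘ j₁) ∘ comp ∘ compr
  snd-j₁-comp-assoc = Comparison.comp-assoc-reflect tensorGraph (underlyingGraph 𝔻) (snd ∘ j₁) uD
    (trans DP.q₁∘universal (sym assoc)) (trans DP.q₂∘universal (sym assoc)) snd-j₁-comp D.comp-assoc

  comp-assoc : comp ∘ compl ≡ comp ∘ compr
  comp-assoc = TensorArrows-ext dom-comp-assoc cod-comp-assoc
    (prod-ext (component fst-j₁-comp-assoc) (component snd-j₁-comp-assoc))
    where
    open GraphWithComposition tensorGraph using (dom-comp-assoc; cod-comp-assoc)
    component : ∀ {A} {π : Hom (C.C₁ × D.C₁) A} →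
                (π ∘ j₁) ∘ comp ∘ compl ≡ (π ∘ j₁) ∘ comp ∘ compr →
                π ∘ j₁ ∘ comp ∘ compl ≡ π ∘ j₁ ∘ comp ∘ compr
    component e = trans (sym assoc) (trans e assoc)

mainTheorem3 : ∀ {o ℓ : Level} (𝒞 : Category o ℓ) (FL : FiniteLimits 𝒞)
                 (SM : SymmetricMonoidal 𝒞)
                 (unit-terminal : IsTerminal 𝒞 (SymmetricMonoidal.unit SM))
                 (ℂ 𝔻 : WithLimits.InternalCategory FL)
                 (T : TensorProduct.Over.TensorArrows FL SM unit-terminal ℂ 𝔻) →
                 Category._∘_ 𝒞 (TensorProduct.Over.Construction.comp FL SM unit-terminal ℂ 𝔻 T)
                                (TensorProduct.Over.Construction.compl FL SM unit-terminal ℂ 𝔻 T)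
                 ≡ Category._∘_ 𝒞 (TensorProduct.Over.Construction.comp FL SM unit-terminal ℂ 𝔻 T)
                                  (TensorProduct.Over.Construction.compr FL SM unit-terminal ℂ 𝔻 T)
mainTheorem3 𝒞 FL SM unit-terminal ℂ 𝔻 T = TensorAssociativity.comp-assoc 𝒞 FL SM unit-terminal ℂ 𝔻 T
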